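{- Let $\mathcal{M}=(S,Act,\bar s,\mathbf{P})$ be an MDP and $\mathfrak{p}=\langle(F_1,E_1),\dots,(F_k,E_k)\rangle$ a tuple of Rabin pairs, $F_i,E_i\subseteq S$. A set $\mathcal{E}\subseteq\mathsf{En}$ is an EC of $\mathcal{M}$ with $S(\mathcal{E})\cap F_i\ne\emptyset$ and $S(\mathcal{E})\subseteq E_i$ for all $i\in[k]$ if and only if there is an EC $\mathcal{E}'$ of the copy MDP $\mathcal{M}^{\mathfrak{p}}$ such that (1) $\mathcal{E}'$ contains a pair $(\langle s,i\rangle,a)$ with $s\in F_i$ for some $i\in[k]$, and (2) $\{(s,a)\mid\exists i\in[k].\ (\langle s,i\rangle,a)\in\mathcal{E}'\}=\mathcal{E}$.
   Context: An MDP $(S,Act,\bar s,\mathbf{P})$ has finite $S,Act$, partial $\mathbf{P}:S\times Act\to\mathrm{Dist}(S)$ (sub-distributions allowed for the copy MDP), enabled pairs $\mathsf{En}$, enabled actions $Act(s)$. An EC of an MDP is a nonempty set $\mathcal{E}$ of enabled pairs such that, with $S(\mathcal{E})$ the set of states occurring in $\mathcal{E}$, every $(s,a)\in\mathcal{E}$ has $\mathbf{P}(s,a,S(\mathcal{E}))=1$ and the graph on $S(\mathcal{E})$ with edges $s\to s'$ whenever $\mathbf{P}(s,a,s')>0$ for some $(s,a)\in\mathcal{E}$ is strongly connected. Copy MDP: let $E=\bigcap_{i=1}^kE_i$ and for $i\in[k]$ let $i\oplus1=1$ if $i=k$ and $i+1$ otherwise. $\mathcal{M}^{\mathfrak{p}}$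 has states $E\times[k]$, actions $Act$, initial state $\langle\bar s,1\rangle$, enabled pairs $(\langle s,i\rangle,a)$ with $s\in E$, $a\in Act(s)$, and $\mathbf{P}^{\mathfrak{p}}(\langle s,i\rangle,a,\langle s',i'\rangle)=\mathbf{P}(s,a,s')$ if ($i=i'$ and $s\notin F_i$) or ($i'=i\oplus1$ and $s\in F_i$), and $0$ otherwise.
   Formalization: The transition probabilities of the MDP $\mathcal{M}$ take values in the rationals. -}

module Defs where

open import Data.Nat as ℕ using (ℕ; zero; suc)
open import Data.Nat.Properties as ℕP using ()
open import Data.Bool using (Bool; true; false; _∧_; _∨_; not; if_then_else_)
open import Data.Fin using (Fin; zero; suc; toℕ; fromℕ<; combine; remQuot; _≟_)
open import Data.Fin.Subset using (Subset)
open import Data.Vec using (lookup)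
open import Data.Product using (Σ; ∃; ∃-syntax; _×_; _,_)
open import Data.Rational using (ℚ; 0ℚ; 1ℚ; _+_; _≤_; _<_)
open import Relation.Nullary using (does; yes; no)
open import Relation.Binary.PropositionalEquality using (_≡_)
open import Relation.Binary.Construct.Closure.ReflexiveTransitive using (Star)

sumFin : ∀ {n} → (Fin n → ℚ) → ℚ
sumFin {zero}  f = 0ℚ
sumFin {suc n} f = f zero + sumFin (λ i → f (suc i))

anyFin : ∀ {n} → (Fin n → Bool) → Bool
anyFin {zero}  f = false
anyFin {suc n} f = f zero ∨ anyFin (λ i → f (suc i))

allFin : ∀ {n} → (Fin n → Bool) → Bool
allFin {zero}  f = true
allFin {suc n} f = f zero ∧ allFin (λ i → f (suc i))

-- The partial transition function is modelled by a total function P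
-- together with the enabledness predicate En: P s a is only meaningful
-- when En s a ≡ true.

record MDP (n m : ℕ) : Set where
  field
    init : Fin n
    En   : Fin n → Fin m → Bool
    P    : Fin n → Fin m → Fin n → ℚ

open MDP public

IsDistMDP : ∀ {n m} → MDP n m → Set
IsDistMDP {n} {m} M =
  (s : Fin n) (a : Fin m) → En M s a ≡ true →
  ((t : Fin n) → 0ℚ ≤ P M s a t) × sumFin (P M s a) ≡ 1ℚ

PairSet : ℕ → ℕ → Set
PairSet n m = Fin n → Fin m → Bool

_∈ᴱ_ : ∀ {n m} → (Fin n × Fin m) → PairSet n m → Set
(s , a) ∈ᴱ ℰ = ℰ s a ≡ true

inS : ∀ {n m} → PairSet n m → Fin n → Bool
inS ℰ s = anyFin (ℰ s)

_∈S_ : ∀ {n m} → Fin n → PairSet n m → Set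
s ∈S ℰ = inS ℰ s ≡ true

mass : ∀ {n m} → MDP n m → Fin n → Fin m → PairSet n m → ℚ
mass M s a ℰ = sumFin (λ t → if inS ℰ t then P M s a t else 0ℚ)

Edge : ∀ {n m} → MDP n m → PairSet n m → Fin n → Fin n → Set
Edge {n} {m} M ℰ s t =
  s ∈S ℰ × t ∈S ℰ × (∃[ a ] ((s , a) ∈ᴱ ℰ × 0ℚ < P M s a t))

record IsEC {n m} (M : MDP n m) (ℰ : PairSet n m) : Set where
  field
    nonempty  : ∃[ s ] ∃[ a ] ((s , a) ∈ᴱ ℰ)
    enabled   : ∀ s a → (s , a) ∈ᴱ ℰ → En M s a ≡ true
    closed    : ∀ s a → (s , a) ∈ᴱ ℰ → mass M s a ℰ ≡ 1ℚ
    connected : ∀ s t → s ∈S ℰ → t ∈S ℰ → Star (Edge M ℰ) s t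

-- Rabin pairs are indexed by Fin (suc k) (i.e. k ≥ 1).
-- State ⟨s,i⟩ is encoded as  combine s i : Fin (n * suc k).
-- States ⟨s,i⟩ with s ∉ E are kept as padding: they have no enabled
-- actions and receive no probability, so they never occur in an EC.

⊕1 : ∀ {k} → Fin (suc k) → Fin (suc k)
⊕1 {k} i with toℕ i ℕ.<? k
... | yes p = fromℕ< (ℕ.s≤s p)
... | no  _ = zero

inE : ∀ {n k} → (Fin (suc k) → Subset n) → Fin n → Bool
inE E s = allFin (λ i → lookup (E i) s)

copyP : ∀ {n m k} → MDP n m → (F E : Fin (suc k) → Subset n) →
        Fin n → Fin (suc k) → Fin m → Fin n → Fin (suc k) → ℚ
copyP M F E s i a s' i' =
  if inE E s ∧ inE E s' ∧
     ((does (i ≟ i') ∧ not (lookup (F i) s)) ∨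
      (does (⊕1 i ≟ i') ∧ lookup (F i) s))
  then P M s a s' else 0ℚ

copyMDP : ∀ {n m k} → MDP n m → (F E : Fin (suc k) → Subset n) →
          MDP (n ℕ.* suc k) m
copyMDP {n} {m} {k} M F E = record
  { init = combine (init M) zero
  ; En   = λ x a → let (s , i) = remQuot {n} (suc k) x in inE E s ∧ En M s a
  ; P    = λ x a y → let (s , i) = remQuot {n} (suc k) x
                         (s' , i') = remQuot {n} (suc k) y
                     in copyP M F E s i a s' i'
  }

-- The copy MDP runs M while cycling through the copies 1, …, k, passing
-- from copy i to copy i ⊕ 1 right after an F_i-state.
-- (⇒) Let ⟶ be the moves of the copy MDP along pairs of ℰ, and pick a bottom strongly
-- connected component of ⟶ (every state it reaches reaches it back). Lifting ℰ to the
-- states reachable from it gives an EC of the copy MDP: it is closed because ℰ is and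
-- E-states carry all of M's probability, and it projects onto all of ℰ because ℰ is
-- strongly connected. Walking from it to an F_i-state along ℰ stays in copy i until an
-- F_i-state is met.
-- (⇐) The copy MDP splits P(s,a,t) over the copies of t, so projecting keeps closedness
-- and edges. If the copy EC contains a pair at an F_j-state in copy j, it moves into
-- copy j ⊕ 1, and strong connectivity forces it back out of copy j ⊕ 1, which is
-- possible only at an F_{j⊕1}-state; going round the cycle, every F_i is met.
module Submission where

open import Defs
open import Data.Nat as ℕ using (ℕ; zero; suc)
open import Data.Bool using (Bool; true; false; _∧_; _∨_; not; if_then_else_)
import Data.Bool as Bool
open import Data.Bool.Properties using (∧-conicalˡ; ∧-conicalʳ; ∧-zeroʳ; ∧-identityʳ; ∨-identityʳ)
open import Data.Fin using (Fin; zero; suc; toℕ; fromℕ; inject₁; combine; remQuot; _↑ˡ_; _↑ʳ_; _≟_)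
open import Data.Fin.Properties
  using (suc-injective; toℕ-injective; toℕ-fromℕ<; toℕ-fromℕ; toℕ-inject₁; toℕ<n; ≤fromℕ; remQuot-combine; combine-remQuot; any?)
open import Data.Fin.Induction using (<-weakInduction; <-weakInduction-startingFrom)
import Data.Nat.Properties as ℕ
open import Data.Product using (∃-syntax; _×_; _,_; proj₁; proj₂; uncurry)
open import Data.Rational using (ℚ; 0ℚ; 1ℚ; _+_; _≤_; _<_)
open import Data.Rational.Properties
  using (≤-refl; ≤-reflexive; ≤-trans; ≤-antisym; <-≤-trans; <-irrefl; ≮⇒≥; +-mono-≤; +-mono-<-≤; +-mono-≤-<; +-identityˡ; +-identityʳ; +-assoc; _<?_; positive⁻¹; module ≤-Reasoning)
open import Data.Sum using (_⊎_; inj₁; inj₂)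
open import Data.List using (List; []; _∷_)
import Data.List as List
open import Data.List.Relation.Unary.Any using (here; there)
open import Data.List.Membership.Propositional using () renaming (_∈_ to _∈ᴸ_)
open import Data.List.Membership.Propositional.Properties using (∈-allFin)
open import Data.Fin.Subset using (Subset; _∈_; _⊂_; ∣_∣)
open import Data.Fin.Subset.Properties using (p⊂q⇒∣p∣<∣q∣)
open import Data.Vec using (tabulate; lookup)
open import Data.Vec.Properties using (lookup∘tabulate; lookup⇒[]=; []=⇒lookup)
open import Function using (_∘_; _on_)
open import Function.Bundles using (_⇔_; mk⇔; Equivalence)
open import Level using (0ℓ)
open import Data.Nat.Induction using (<-wellFounded)
open import Induction.WellFounded using (Acc; acc)
open import Relation.Unary using (Pred)
open import Relation.Binary using (Rel; Decidable)
import Relation.Binary.Construct.On as On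
open import Relation.Binary.Construct.Closure.ReflexiveTransitive using (Star; ε; _◅_; _◅◅_; gmap)
open import Relation.Nullary using (Dec; yes; no; does; contradiction)
open import Relation.Nullary.Decidable using (_⊎-dec_; _×-dec_; ¬?; map′; dec-true; dec-false; decidable-stable)
open import Relation.Binary.PropositionalEquality

anyFin⁺ : ∀ {n} (f : Fin n → Bool) i → f i ≡ true → anyFin f ≡ true
anyFin⁺ f zero    fi≡true rewrite fi≡true = refl
anyFin⁺ f (suc i) fi≡true with f zero
... | true  = refl
... | false = anyFin⁺ (f ∘ suc) i fi≡true

anyFin⁻ : ∀ {n} (f : Fin n → Bool) → anyFin f ≡ true → ∃[ i ] f i ≡ true
anyFin⁻ {suc n} f any≡true with f zero in f0≡true
... | true  = zero , f0≡true
... | false with anyFin⁻ (f ∘ suc) any≡true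
...   | i , fi≡true = suc i , fi≡true

allFin⁺ : ∀ {n} (f : Fin n → Bool) → (∀ i → f i ≡ true) → allFin f ≡ true
allFin⁺ {zero}  f all-true = refl
allFin⁺ {suc n} f all-true rewrite all-true zero = allFin⁺ (f ∘ suc) (all-true ∘ suc)

allFin⁻ : ∀ {n} (f : Fin n → Bool) → allFin f ≡ true → ∀ i → f i ≡ true
allFin⁻ f all≡true zero    = ∧-conicalˡ (f zero) _ all≡true
allFin⁻ f all≡true (suc i) = allFin⁻ (f ∘ suc) (∧-conicalʳ (f zero) _ all≡true) i

does-true⇒ : ∀ {p} {A : Set p} (a? : Dec A) → does a? ≡ true → A
does-true⇒ (yes a) _ = a

-- Definitionally the shape of the summands of mass and copyP in Defs.
guard : Bool → ℚ → ℚ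
guard b x = if b then x else 0ℚ

guard-nonneg : ∀ b {x} → 0ℚ ≤ x → 0ℚ ≤ guard b x
guard-nonneg true  0≤x = 0≤x
guard-nonneg false _   = ≤-refl

guard-≤ : ∀ b {x} → 0ℚ ≤ x → guard b x ≤ x
guard-≤ true  _   = ≤-refl
guard-≤ false 0≤x = 0≤x

guard-mono : ∀ b {x y} → x ≤ y → guard b x ≤ guard b y
guard-mono true  x≤y = x≤y
guard-mono false _   = ≤-refl

guard-pos⁻ : ∀ b {x} → 0ℚ < guard b x → b ≡ true × 0ℚ < x
guard-pos⁻ true  0<x = refl , 0<x
guard-pos⁻ false 0<0 = contradiction 0<0 (<-irrefl refl)

guard-redundant : ∀ b {x} → (0ℚ < x → b ≡ true) → 0ℚ ≤ x → guard b x ≡ x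
guard-redundant true  _      _   = refl
guard-redundant false 0<x⇒b 0≤x = ≤-antisym 0≤x (≮⇒≥ λ 0<x → contradiction (0<x⇒b 0<x) λ ())

sumFin-cong : ∀ {n} {f g : Fin n → ℚ} → (∀ i → f i ≡ g i) → sumFin f ≡ sumFin g
sumFin-cong {zero}  f≗g = refl
sumFin-cong {suc n} f≗g = cong₂ _+_ (f≗g zero) (sumFin-cong (f≗g ∘ suc))

sumFin-mono-≤ : ∀ {n} {f g : Fin n → ℚ} → (∀ i → f i ≤ g i) → sumFin f ≤ sumFin g
sumFin-mono-≤ {zero}  f≤g = ≤-refl
sumFin-mono-≤ {suc n} f≤g = +-mono-≤ (f≤g zero) (sumFin-mono-≤ (f≤g ∘ suc))

sumFin-mono-< : ∀ {n} {f g : Fin n → ℚ} → (∀ i → f i ≤ g i) → ∀ j → f j < g j → sumFin f < sumFin g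
sumFin-mono-< f≤g zero    fj<gj = +-mono-<-≤ fj<gj (sumFin-mono-≤ (f≤g ∘ suc))
sumFin-mono-< f≤g (suc j) fj<gj = +-mono-≤-< (f≤g zero) (sumFin-mono-< (f≤g ∘ suc) j fj<gj)

sumFin-zero : ∀ {n} (f : Fin n → ℚ) → (∀ i → f i ≡ 0ℚ) → sumFin f ≡ 0ℚ
sumFin-zero {zero}  f f≗0 = refl
sumFin-zero {suc n} f f≗0 rewrite f≗0 zero | sumFin-zero (f ∘ suc) (f≗0 ∘ suc) = refl

sumFin-single : ∀ {n} (f : Fin n → ℚ) j → (∀ i → i ≢ j → f i ≡ 0ℚ) → sumFin f ≡ f j
sumFin-single f zero    off = trans (cong (f zero +_) (sumFin-zero (f ∘ suc) (λ i → off (suc i) λ ())))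
                                    (+-identityʳ (f zero))
sumFin-single f (suc j) off = trans (cong (_+ sumFin (f ∘ suc)) (off zero λ ()))
  (trans (+-identityˡ _) (sumFin-single (f ∘ suc) j (λ i i≢j → off (suc i) (i≢j ∘ suc-injective))))

sumFin-pos⇒ : ∀ {n} (f : Fin n → ℚ) → 0ℚ < sumFin f → ∃[ i ] 0ℚ < f i
sumFin-pos⇒ {zero}  f 0<0 = contradiction 0<0 (<-irrefl refl)
sumFin-pos⇒ {suc n} f 0<Σf with 0ℚ <? f zero | 0ℚ <? sumFin (f ∘ suc)
... | yes 0<f0 | _        = zero , 0<f0
... | no  _    | yes 0<Σ  = let i , 0<fi = sumFin-pos⇒ (f ∘ suc) 0<Σ in suc i , 0<fi
... | no  0≮f0 | no  0≮Σ  = contradiction (<-≤-trans 0<Σf Σf≤0) (<-irrefl refl)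
  where Σf≤0 = ≤-trans (+-mono-≤ (≮⇒≥ 0≮f0) (≮⇒≥ 0≮Σ)) (≤-reflexive (+-identityˡ 0ℚ))

sumFin-↑ : ∀ a b (f : Fin (a ℕ.+ b) → ℚ) → sumFin f ≡ sumFin (λ i → f (i ↑ˡ b)) + sumFin (λ i → f (a ↑ʳ i))
sumFin-↑ zero    b f = sym (+-identityˡ _)
sumFin-↑ (suc a) b f rewrite sumFin-↑ a b (f ∘ suc) = sym (+-assoc (f zero) _ _)

sumFin-combine : ∀ n k (f : Fin (n ℕ.* k) → ℚ) → sumFin f ≡ sumFin {n} (λ s → sumFin {k} (λ j → f (combine s j)))
sumFin-combine zero    k f = refl
sumFin-combine (suc n) k f rewrite sumFin-↑ k (n ℕ.* k) f =
  cong (sumFin (λ j → f (j ↑ˡ (n ℕ.* k))) +_) (sumFin-combine n k (λ i → f (k ↑ʳ i)))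

sumFin-guard-≤ : ∀ {n} (c : Fin n → Bool) b (f : Fin n → ℚ) → (∀ i → c i ≡ true → b ≡ true) →
                 (∀ i → 0ℚ ≤ f i) → sumFin (λ i → guard (c i) (f i)) ≤ guard b (sumFin f)
sumFin-guard-≤ c true  f _   f≥0 = sumFin-mono-≤ (λ i → guard-≤ (c i) (f≥0 i))
sumFin-guard-≤ c false f c⇒b _   = ≤-reflexive (sumFin-zero _ off)
  where
  off : ∀ i → guard (c i) (f i) ≡ 0ℚ
  off i with c i in ci≡true
  ... | true  = contradiction (c⇒b i ci≡true) λ ()
  ... | false = refl

module _ {n m} (ℰ : PairSet n m) where

  ∈S⁺ : ∀ {s a} → (s , a) ∈ᴱ ℰ → s ∈S ℰ
  ∈S⁺ {s} {a} = anyFin⁺ (ℰ s) a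

  ∈S⁻ : ∀ {s} → s ∈S ℰ → ∃[ a ] (s , a) ∈ᴱ ℰ
  ∈S⁻ {s} = anyFin⁻ (ℰ s)

module _ {n m} {M : MDP n m} {ℰ : PairSet n m} (ec : IsEC M ℰ) where

  EC-successor : ∀ {s a} → (s , a) ∈ᴱ ℰ → ∃[ t ] (t ∈S ℰ × 0ℚ < P M s a t)
  EC-successor {s} {a} e
    with t , 0<mass-t ← sumFin-pos⇒ _ (subst (0ℚ <_) (sym (IsEC.closed ec s a e)) (positive⁻¹ 1ℚ))
    with t∈S , 0<P ← guard-pos⁻ (inS ℰ t) 0<mass-t
    = t , t∈S , 0<P

  EC-successor-closed : ∀ {s a t} → (∀ u → 0ℚ ≤ P M s a u) → sumFin (P M s a) ≤ 1ℚ →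
                        (s , a) ∈ᴱ ℰ → 0ℚ < P M s a t → t ∈S ℰ
  EC-successor-closed {s} {a} {t} P≥0 ΣP≤1 e 0<P with inS ℰ t in t∈S?
  ... | true  = refl
  ... | false = contradiction (<-≤-trans mass<ΣP ΣP≤1) (<-irrefl (IsEC.closed ec s a e))
    where
    mass<ΣP : mass M s a ℰ < sumFin (P M s a)
    mass<ΣP = sumFin-mono-< (λ u → guard-≤ (inS ℰ u) (P≥0 u)) t
                            (subst (λ b → guard b (P M s a t) < P M s a t) (sym t∈S?) 0<P)

module Reachability {N : ℕ} {ℓ} (_⟶_ : Rel (Fin N) ℓ) (_⟶?_ : Decidable _⟶_) where

  _⟶*_ : Rel (Fin N) ℓ
  _⟶*_ = Star _⟶_

  -- Floyd–Warshall: paths whose intermediate vertices all lie in the given list.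
  Via : List (Fin N) → Rel (Fin N) ℓ
  Via []       x y = x ≡ y ⊎ x ⟶ y
  Via (v ∷ vs) x y = Via vs x y ⊎ (Via vs x v × Via vs v y)

  via? : ∀ vs → Decidable (Via vs)
  via? []       x y = (x ≟ y) ⊎-dec (x ⟶? y)
  via? (v ∷ vs) x y = via? vs x y ⊎-dec (via? vs x v ×-dec via? vs v y)

  via⇒⟶* : ∀ vs {x y} → Via vs x y → x ⟶* y
  via⇒⟶* []       (inj₁ refl)        = ε
  via⇒⟶* []       (inj₂ x⟶y)         = x⟶y ◅ ε
  via⇒⟶* (v ∷ vs) (inj₁ p)           = via⇒⟶* vs p
  via⇒⟶* (v ∷ vs) (inj₂ (p , q))     = via⇒⟶* vs p ◅◅ via⇒⟶* vs q

  via-step : ∀ vs {x y} → x ≡ y ⊎ x ⟶ y → Via vs x y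
  via-step []       p = p
  via-step (v ∷ vs) p = inj₁ (via-step vs p)

  via-trans : ∀ vs {x v y} → v ∈ᴸ vs → Via vs x v → Via vs v y → Via vs x y
  via-trans (w ∷ vs) (here refl) p q = inj₂ (to-w p , from-w q)
    where
    to-w : ∀ {x} → Via (w ∷ vs) x w → Via vs x w
    to-w (inj₁ p)       = p
    to-w (inj₂ (p , _)) = p
    from-w : ∀ {y} → Via (w ∷ vs) w y → Via vs w y
    from-w (inj₁ q)       = q
    from-w (inj₂ (_ , q)) = q
  via-trans (w ∷ vs) (there v∈) (inj₁ p)        (inj₁ q)        = inj₁ (via-trans vs v∈ p q)
  via-trans (w ∷ vs) (there v∈) (inj₁ p)        (inj₂ (q , q′)) = inj₂ (via-trans vs v∈ p q , q′)
  via-trans (w ∷ vs) (there v∈) (inj₂ (p , p′)) (inj₁ q)        = inj₂ (p , via-trans vs v∈ p′ q)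
  via-trans (w ∷ vs) (there v∈) (inj₂ (p , _))  (inj₂ (_ , q))  = inj₂ (p , q)

  ⟶*⇒via : ∀ {x y} → x ⟶* y → Via (List.allFin N) x y
  ⟶*⇒via ε                      = via-step _ (inj₁ refl)
  ⟶*⇒via (_◅_ {j = v} x⟶v v⟶*y) = via-trans _ (∈-allFin v) (via-step _ (inj₂ x⟶v)) (⟶*⇒via v⟶*y)

  reachable? : Decidable _⟶*_
  reachable? x y = map′ (via⇒⟶* _) ⟶*⇒via (via? _ x y)

  reachSet : Fin N → Subset N
  reachSet x = tabulate (does ∘ reachable? x)

  ∈reachSet⁺ : ∀ {x y} → x ⟶* y → y ∈ reachSet x
  ∈reachSet⁺ {x} {y} x⟶*y =
    lookup⇒[]= y _ (trans (lookup∘tabulate _ y) (dec-true (reachable? x y) x⟶*y))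

  ∈reachSet⁻ : ∀ {x y} → y ∈ reachSet x → x ⟶* y
  ∈reachSet⁻ {x} {y} y∈ = does-true⇒ (reachable? x y) (trans (sym (lookup∘tabulate _ y)) ([]=⇒lookup y∈))

  IsBottom : Fin N → Set ℓ
  IsBottom b = ∀ y → b ⟶* y → y ⟶* b

  bottom-reachable : ∀ x → ∃[ b ] (x ⟶* b × IsBottom b)
  bottom-reachable x = go x (On.wellFounded (∣_∣ ∘ reachSet) <-wellFounded x)
    where
    go : ∀ x → Acc (ℕ._<_ on (∣_∣ ∘ reachSet)) x → ∃[ b ] (x ⟶* b × IsBottom b)
    go x (acc smaller) with any? (λ y → reachable? x y ×-dec ¬? (reachable? y x))
    ... | no ¬escape = x , ε , λ y x⟶*y →
      decidable-stable (reachable? y x) λ y↛*x → ¬escape (y , x⟶*y , y↛*x)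
    ... | yes (y , x⟶*y , y↛*x) =
      let b , y⟶*b , b-bottom = go y (smaller (p⊂q⇒∣p∣<∣q∣ reach-y⊂reach-x)) in b , x⟶*y ◅◅ y⟶*b , b-bottom
      where
      reach-y⊂reach-x : reachSet y ⊂ reachSet x
      reach-y⊂reach-x = (λ z∈ → ∈reachSet⁺ (x⟶*y ◅◅ ∈reachSet⁻ z∈)) , x , ∈reachSet⁺ ε , y↛*x ∘ ∈reachSet⁻

inE⁺ : ∀ {n k} {E : Fin (suc k) → Subset n} {s} → (∀ i → s ∈ E i) → inE E s ≡ true
inE⁺ {E = E} {s} s∈E = allFin⁺ (λ i → lookup (E i) s) (λ i → []=⇒lookup (s∈E i))

inE⁻ : ∀ {n k} {E : Fin (suc k) → Subset n} {s} → inE E s ≡ true → ∀ i → s ∈ E i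
inE⁻ {E = E} {s} s∈E i = lookup⇒[]= s (E i) (allFin⁻ (λ i → lookup (E i) s) s∈E i)

⊕1-inject₁ : ∀ {k} (j : Fin k) → ⊕1 (inject₁ j) ≡ suc j
⊕1-inject₁ {k} j with toℕ (inject₁ j) ℕ.<? k
... | yes j<k = toℕ-injective (trans (toℕ-fromℕ< (ℕ.s≤s j<k)) (cong suc (toℕ-inject₁ j)))
... | no  j≮k = contradiction (subst (ℕ._< k) (sym (toℕ-inject₁ j)) (toℕ<n j)) j≮k

⊕1-fromℕ : ∀ k → ⊕1 (fromℕ k) ≡ zero
⊕1-fromℕ k with toℕ (fromℕ k) ℕ.<? k
... | yes k<k = contradiction (subst (ℕ._< k) (toℕ-fromℕ k) k<k) (ℕ.<-irrefl refl)
... | no  _   = refl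

⊕1-invariant⇒all : ∀ {k ℓ} (Q : Pred (Fin (suc k)) ℓ) → (∀ j → Q j → Q (⊕1 j)) → ∀ {i} → Q i → ∀ j → Q j
⊕1-invariant⇒all Q step {i} Qi = <-weakInduction Q Q-zero Q-suc
  where
  Q-suc : ∀ j → Q (inject₁ j) → Q (suc j)
  Q-suc j = subst Q (⊕1-inject₁ j) ∘ step (inject₁ j)
  Q-zero : Q zero
  Q-zero = subst Q (⊕1-fromℕ _) (step _ (<-weakInduction-startingFrom Q Qi Q-suc (≤fromℕ i)))

module Copy {n m k} (M : MDP n m) (F E : Fin (suc k) → Subset n) where

  Mᶜ : MDP (n ℕ.* suc k) m
  Mᶜ = copyMDP M F E

  π : Fin (n ℕ.* suc k) → Fin n
  π x = proj₁ (remQuot {n} (suc k) x)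

  index : Fin (n ℕ.* suc k) → Fin (suc k)
  index x = proj₂ (remQuot {n} (suc k) x)

  π-combine : ∀ s i → π (combine s i) ≡ s
  π-combine s i = cong proj₁ (remQuot-combine {n} {suc k} s i)

  index-combine : ∀ s i → index (combine s i) ≡ i
  index-combine s i = cong proj₂ (remQuot-combine {n} {suc k} s i)

  combine-π-index : ∀ x → combine (π x) (index x) ≡ x
  combine-π-index = combine-remQuot {n} (suc k)

  next : Fin (suc k) → Fin n → Fin (suc k)
  next i s = if lookup (F i) s then ⊕1 i else i

  next-∈ : ∀ {i s} → lookup (F i) s ≡ true → next i s ≡ ⊕1 i
  next-∈ s∈F rewrite s∈F = refl

  next-∉ : ∀ {i s} → lookup (F i) s ≢ true → next i s ≡ i
  next-∉ {i} {s} s∉F with lookup (F i) s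
  ... | true  = contradiction refl s∉F
  ... | false = refl

  copyP-guard : ∀ s i a t j → copyP M F E s i a t j ≡ guard (inE E s ∧ inE E t ∧ does (next i s ≟ j)) (P M s a t)
  copyP-guard s i a t j = cong (λ c → guard (inE E s ∧ inE E t ∧ c) (P M s a t)) (jump-condition (lookup (F i) s))
    where
    jump-condition : ∀ b → ((does (i ≟ j) ∧ not b) ∨ (does (⊕1 i ≟ j) ∧ b)) ≡ does ((if b then ⊕1 i else i) ≟ j)
    jump-condition true  rewrite ∧-zeroʳ (does (i ≟ j)) | ∧-identityʳ (does (⊕1 i ≟ j)) = refl
    jump-condition false rewrite ∧-zeroʳ (does (⊕1 i ≟ j)) | ∧-identityʳ (does (i ≟ j)) = ∨-identityʳ _

  copyP-pos⁻ : ∀ {s i a t j} → 0ℚ < copyP M F E s i a t j → 0ℚ < P M s a t × inE E t ≡ true × next i s ≡ j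
  copyP-pos⁻ {s} {i} {a} {t} {j} 0<copyP
    with cond , 0<P ← guard-pos⁻ _ (subst (0ℚ <_) (copyP-guard s i a t j) 0<copyP)
    with t-cond ← ∧-conicalʳ (inE E s) _ cond
    = 0<P , ∧-conicalˡ (inE E t) _ t-cond , does-true⇒ (next i s ≟ j) (∧-conicalʳ (inE E t) _ t-cond)

  Pᶜ-pos⁻ : ∀ {x a y} → 0ℚ < P Mᶜ x a y → 0ℚ < P M (π x) a (π y) × inE E (π y) ≡ true × next (index x) (π x) ≡ index y
  Pᶜ-pos⁻ = copyP-pos⁻

  copyP-next : ∀ {s i a t} → inE E s ≡ true → copyP M F E s i a t (next i s) ≡ guard (inE E t) (P M s a t)
  copyP-next {s} {i} {a} {t} s∈E
    rewrite copyP-guard s i a t (next i s) | s∈E | dec-true (next i s ≟ next i s) refl | ∧-identityʳ (inE E t)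
    = refl

  copyP-off : ∀ {s i a t j} → j ≢ next i s → copyP M F E s i a t j ≡ 0ℚ
  copyP-off {s} {i} {a} {t} {j} j≢next
    rewrite copyP-guard s i a t j | dec-false (next i s ≟ j) (j≢next ∘ sym) | ∧-zeroʳ (inE E t) | ∧-zeroʳ (inE E s)
    = refl

  copyP-nonneg : ∀ {s i a t j} → 0ℚ ≤ P M s a t → 0ℚ ≤ copyP M F E s i a t j
  copyP-nonneg {s} {i} {a} {t} {j} 0≤P rewrite copyP-guard s i a t j = guard-nonneg _ 0≤P

  Pᶜ-combine : ∀ x a t j → P Mᶜ x a (combine t j) ≡ copyP M F E (π x) (index x) a t j
  Pᶜ-combine x a t j = cong (uncurry (copyP M F E (π x) (index x) a)) (remQuot-combine {n} {suc k} t j)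

  Pᶜ-combine₂ : ∀ s i a t j → P Mᶜ (combine s i) a (combine t j) ≡ copyP M F E s i a t j
  Pᶜ-combine₂ s i a t j = cong₂ (λ x y → uncurry (uncurry (copyP M F E) x a) y)
                                (remQuot-combine {n} {suc k} s i) (remQuot-combine {n} {suc k} t j)

  Pᶜ-nonneg : IsDistMDP M → ∀ {x a} → En M (π x) a ≡ true → ∀ y → 0ℚ ≤ P Mᶜ x a y
  Pᶜ-nonneg dist en y = copyP-nonneg (proj₁ (dist _ _ en) (π y))

  sum-copies : ∀ {x a} t → inE E (π x) ≡ true → sumFin (λ j → P Mᶜ x a (combine t j)) ≡ guard (inE E t) (P M (π x) a t)
  sum-copies {x} {a} t x∈E = begin
    sumFin (λ j → P Mᶜ x a (combine t j))            ≡⟨ sumFin-cong (Pᶜ-combine x a t) ⟩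
    sumFin (copyP M F E (π x) (index x) a t)          ≡⟨ sumFin-single _ (next (index x) (π x)) (λ _ → copyP-off) ⟩
    copyP M F E (π x) (index x) a t (next (index x) (π x)) ≡⟨ copyP-next x∈E ⟩
    guard (inE E t) (P M (π x) a t)                   ∎
    where open ≡-Reasoning

  sum-copy-states : ∀ {x a} → inE E (π x) ≡ true → sumFin (P Mᶜ x a) ≡ sumFin (λ t → guard (inE E t) (P M (π x) a t))
  sum-copy-states x∈E = trans (sumFin-combine n (suc k) _) (sumFin-cong λ t → sum-copies t x∈E)

  Hits : PairSet (n ℕ.* suc k) m → Fin (suc k) → Set
  Hits ℰ' i = ∃[ s ] ∃[ a ] ((combine s i , a) ∈ᴱ ℰ' × s ∈ F i)

  hits-at : ∀ {ℰ' x a} → (x , a) ∈ᴱ ℰ' → lookup (F (index x)) (π x) ≡ true → Hits ℰ' (index x)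
  hits-at {ℰ'} {x} {a} e x∈F = π x , a , subst (λ y → (y , a) ∈ᴱ ℰ') (sym (combine-π-index x)) e , lookup⇒[]= _ _ x∈F

  HitsSome : PairSet (n ℕ.* suc k) m → Set
  HitsSome ℰ' = ∃[ s ] ∃[ i ] ∃[ a ] ((combine s i , a) ∈ᴱ ℰ' × s ∈ F i)

  _ProjectsTo_ : PairSet (n ℕ.* suc k) m → PairSet n m → Set
  ℰ' ProjectsTo ℰ = ∀ s a → ((s , a) ∈ᴱ ℰ) ⇔ (∃[ i ] ((combine s i , a) ∈ᴱ ℰ'))

module LiftEC {n m k} (M : MDP n m) (dist : IsDistMDP M) (F E : Fin (suc k) → Subset n)
              {ℰ : PairSet n m} (ec : IsEC M ℰ) (ℰ⊆E : ∀ i s → s ∈S ℰ → s ∈ E i) where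

  open Copy M F E

  S⊆E : ∀ {s} → s ∈S ℰ → inE E s ≡ true
  S⊆E {s} s∈S = inE⁺ (λ i → ℰ⊆E i s s∈S)

  successor∈S : ∀ {s a t} → (s , a) ∈ᴱ ℰ → 0ℚ < P M s a t → t ∈S ℰ
  successor∈S {s} {a} e = EC-successor-closed ec (proj₁ (dist s a en)) (≤-reflexive (proj₂ (dist s a en))) e
    where en = IsEC.enabled ec s a e

  _⟶_ : Rel (Fin (n ℕ.* suc k)) 0ℓ
  x ⟶ y = ∃[ a ] ((π x , a) ∈ᴱ ℰ × 0ℚ < P Mᶜ x a y)

  _⟶?_ : Decidable _⟶_
  x ⟶? y = any? λ a → (ℰ (π x) a Bool.≟ true) ×-dec (0ℚ <? P Mᶜ x a y)

  open Reachability _⟶_ _⟶?_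

  ⟶*-π : ∀ {x y} → x ⟶* y → π x ∈S ℰ → π y ∈S ℰ
  ⟶*-π ε                            x∈S = x∈S
  ⟶*-π ((a , e , 0<Pᶜ) ◅ x₁⟶*y) _   = ⟶*-π x₁⟶*y (successor∈S e (proj₁ (Pᶜ-pos⁻ 0<Pᶜ)))

  edge-lift : ∀ {s t} → Edge M ℰ s t → ∀ i → combine s i ⟶ combine t (next i s)
  edge-lift {s} {t} (s∈S , t∈S , a , e , 0<P) i =
    a , subst (λ u → (u , a) ∈ᴱ ℰ) (sym (π-combine s i)) e , subst (0ℚ <_) (sym Pᶜ≡P) 0<P
    where
    Pᶜ≡P : P Mᶜ (combine s i) a (combine t (next i s)) ≡ P M s a t
    Pᶜ≡P = begin
      P Mᶜ (combine s i) a (combine t (next i s)) ≡⟨ Pᶜ-combine₂ s i a t (next i s) ⟩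
      copyP M F E s i a t (next i s)              ≡⟨ copyP-next (S⊆E s∈S) ⟩
      guard (inE E t) (P M s a t)                 ≡⟨ cong (λ b → guard b (P M s a t)) (S⊆E t∈S) ⟩
      P M s a t                                   ∎
      where open ≡-Reasoning

  path-lift : ∀ {s t} → Star (Edge M ℰ) s t → ∀ i → ∃[ j ] (combine s i ⟶* combine t j)
  path-lift ε         i = i , ε
  path-lift {s} (e ◅ p) i = let j , q = path-lift p (next i s) in j , edge-lift e i ◅ q

  path-lift-to-F : ∀ {s t i} → Star (Edge M ℰ) s t → lookup (F i) t ≡ true →
                   ∃[ u ] (combine s i ⟶* combine u i × lookup (F i) u ≡ true)
  path-lift-to-F {s} ε t∈F = s , ε , t∈F
  path-lift-to-F {s} {i = i} (_◅_ {j = v} e p) t∈F with lookup (F i) s Bool.≟ true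
  ... | yes s∈F = s , ε , s∈F
  ... | no  s∉F = let u , q , u∈F = path-lift-to-F p t∈F
                in u , subst (λ j → combine s i ⟶ combine v j) (next-∉ s∉F) (edge-lift e i) ◅ q , u∈F

  module FromBottom {b} (b∈S : π b ∈S ℰ) (b-bottom : IsBottom b) where

    ℰᶜ : PairSet (n ℕ.* suc k) m
    ℰᶜ y a = does (reachable? b y) ∧ ℰ (π y) a

    ∈ℰᶜ⁺ : ∀ {y a} → b ⟶* y → (π y , a) ∈ᴱ ℰ → (y , a) ∈ᴱ ℰᶜ
    ∈ℰᶜ⁺ {y} b⟶*y e = cong₂ _∧_ (dec-true (reachable? b y) b⟶*y) e

    ∈ℰᶜ⁻ : ∀ {y a} → (y , a) ∈ᴱ ℰᶜ → b ⟶* y × (π y , a) ∈ᴱ ℰ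
    ∈ℰᶜ⁻ {y} e = does-true⇒ (reachable? b y) (∧-conicalˡ _ _ e) , ∧-conicalʳ (does (reachable? b y)) _ e

    reachable⇒∈S : ∀ {y} → b ⟶* y → y ∈S ℰᶜ
    reachable⇒∈S b⟶*y = ∈S⁺ ℰᶜ (∈ℰᶜ⁺ b⟶*y (proj₂ (∈S⁻ ℰ (⟶*-π b⟶*y b∈S))))

    ∈S⇒reachable : ∀ {y} → y ∈S ℰᶜ → b ⟶* y
    ∈S⇒reachable y∈S = proj₁ (∈ℰᶜ⁻ (proj₂ (∈S⁻ ℰᶜ y∈S)))

    ℰᶜ-closed : ∀ y a → (y , a) ∈ᴱ ℰᶜ → mass Mᶜ y a ℰᶜ ≡ 1ℚ
    ℰᶜ-closed y a e = begin
      mass Mᶜ y a ℰᶜ                                  ≡⟨ sumFin-cong (λ z → guard-redundant (inS ℰᶜ z)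
                                                           (λ 0<Pᶜ → reachable⇒∈S (b⟶*y ◅◅ (a , ey , 0<Pᶜ) ◅ ε))
                                                           (Pᶜ-nonneg dist en z)) ⟩
      sumFin (P Mᶜ y a)                               ≡⟨ sum-copy-states (S⊆E (∈S⁺ ℰ ey)) ⟩
      sumFin (λ t → guard (inE E t) (P M (π y) a t))  ≡⟨ sumFin-cong (λ t → guard-redundant (inE E t)
                                                           (S⊆E ∘ successor∈S ey) (proj₁ (dist _ _ en) t)) ⟩
      sumFin (P M (π y) a)                            ≡⟨ proj₂ (dist _ _ en) ⟩
      1ℚ                                              ∎
      where
      open ≡-Reasoning
      b⟶*y = proj₁ (∈ℰᶜ⁻ e)
      ey   = proj₂ (∈ℰᶜ⁻ e)
      en   = IsEC.enabled ec _ _ ey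

    ⟶*⇒edges : ∀ {x z} → b ⟶* x → x ⟶* z → Star (Edge Mᶜ ℰᶜ) x z
    ⟶*⇒edges b⟶*x ε = ε
    ⟶*⇒edges b⟶*x ((a , e , 0<Pᶜ) ◅ p) =
      (reachable⇒∈S b⟶*x , reachable⇒∈S b⟶*y , a , ∈ℰᶜ⁺ b⟶*x e , 0<Pᶜ) ◅ ⟶*⇒edges b⟶*y p
      where b⟶*y = b⟶*x ◅◅ (a , e , 0<Pᶜ) ◅ ε

    ℰᶜ-EC : IsEC Mᶜ ℰᶜ
    ℰᶜ-EC = record
      { nonempty  = b , proj₁ (∈S⁻ ℰ b∈S) , ∈ℰᶜ⁺ ε (proj₂ (∈S⁻ ℰ b∈S))
      ; enabled   = λ y a e → let ey = proj₂ (∈ℰᶜ⁻ e) in cong₂ _∧_ (S⊆E (∈S⁺ ℰ ey)) (IsEC.enabled ec _ _ ey)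
      ; closed    = ℰᶜ-closed
      ; connected = λ x z x∈S z∈S → let b⟶*x = ∈S⇒reachable x∈S in
                      ⟶*⇒edges b⟶*x (b-bottom x b⟶*x ◅◅ ∈S⇒reachable z∈S)
      }

    reach-from-b : ∀ {t} → t ∈S ℰ → ∃[ j ] (b ⟶* combine t j)
    reach-from-b {t} t∈S = subst (λ x → ∃[ j ] (x ⟶* combine t j)) (combine-π-index b)
                             (path-lift (IsEC.connected ec (π b) _ b∈S t∈S) (index b))

    ℰᶜ-projects : ℰᶜ ProjectsTo ℰ
    ℰᶜ-projects s a = mk⇔
      (λ e → let j , b⟶*sj = reach-from-b (∈S⁺ ℰ e) in
               j , ∈ℰᶜ⁺ b⟶*sj (subst (λ u → (u , a) ∈ᴱ ℰ) (sym (π-combine s j)) e))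
      (λ (i , e) → subst (λ u → (u , a) ∈ᴱ ℰ) (π-combine s i) (proj₂ (∈ℰᶜ⁻ e)))

    ℰᶜ-hits : (∀ i → ∃[ s ] (s ∈S ℰ × s ∈ F i)) → HitsSome ℰᶜ
    ℰᶜ-hits hitsF
      with f , f∈S , f∈F ← hitsF (index b)
      with u , b⟶*u , u∈F ← path-lift-to-F (IsEC.connected ec (π b) f b∈S f∈S) ([]=⇒lookup f∈F)
      with b⟶*ub ← subst (_⟶* combine u (index b)) (combine-π-index b) b⟶*u
      with a , e ← ∈S⁻ ℰᶜ (reachable⇒∈S b⟶*ub)
      = u , index b , a , e , lookup⇒[]= u (F (index b)) u∈F

  lifted-EC : (∀ i → ∃[ s ] (s ∈S ℰ × s ∈ F i)) → ∃[ ℰ' ] (IsEC Mᶜ ℰ' × HitsSome ℰ' × ℰ' ProjectsTo ℰ)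
  lifted-EC hitsF
    with s₀ , a₀ , e₀ ← IsEC.nonempty ec
    with b , s₀⟶*b , b-bottom ← bottom-reachable (combine s₀ zero)
    = let open FromBottom (⟶*-π s₀⟶*b (subst (_∈S ℰ) (sym (π-combine s₀ zero)) (∈S⁺ ℰ e₀))) b-bottom
      in ℰᶜ , ℰᶜ-EC , ℰᶜ-hits hitsF , ℰᶜ-projects

module ProjectEC {n m k} (M : MDP n m) (dist : IsDistMDP M) (F E : Fin (suc k) → Subset n)
            {ℰ : PairSet n m} {ℰᶜ : PairSet (n ℕ.* suc k) m}
            (ecᶜ : IsEC (copyMDP M F E) ℰᶜ) (projects : Copy._ProjectsTo_ M F E ℰᶜ ℰ) where

  open Copy M F E

  ∈ℰ⁺ : ∀ {s i a} → (combine s i , a) ∈ᴱ ℰᶜ → (s , a) ∈ᴱ ℰ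
  ∈ℰ⁺ {s} {i} {a} e = Equivalence.from (projects s a) (i , e)

  ∈ℰ⁺-π : ∀ {x a} → (x , a) ∈ᴱ ℰᶜ → (π x , a) ∈ᴱ ℰ
  ∈ℰ⁺-π {x} {a} e = ∈ℰ⁺ (subst (λ y → (y , a) ∈ᴱ ℰᶜ) (sym (combine-π-index x)) e)

  ∈ℰ⁻ : ∀ {s a} → (s , a) ∈ᴱ ℰ → ∃[ i ] ((combine s i , a) ∈ᴱ ℰᶜ)
  ∈ℰ⁻ {s} {a} = Equivalence.to (projects s a)

  ∈S-π : ∀ {x} → x ∈S ℰᶜ → π x ∈S ℰ
  ∈S-π x∈S = ∈S⁺ ℰ (∈ℰ⁺-π (proj₂ (∈S⁻ ℰᶜ x∈S)))

  ∈S-copy : ∀ {s} → s ∈S ℰ → ∃[ i ] (combine s i ∈S ℰᶜ)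
  ∈S-copy s∈S = let i , e = ∈ℰ⁻ (proj₂ (∈S⁻ ℰ s∈S)) in i , ∈S⁺ ℰᶜ e

  enabledᶜ : ∀ {x a} → (x , a) ∈ᴱ ℰᶜ → inE E (π x) ≡ true × En M (π x) a ≡ true
  enabledᶜ {x} {a} e = ∧-conicalˡ _ _ en , ∧-conicalʳ (inE E (π x)) _ en
    where en = IsEC.enabled ecᶜ x a e

  mass-π : ∀ {x a} → (x , a) ∈ᴱ ℰᶜ → mass Mᶜ x a ℰᶜ ≤ mass M (π x) a ℰ
  mass-π {x} {a} e = begin
    mass Mᶜ x a ℰᶜ
      ≡⟨ sumFin-combine n (suc k) _ ⟩
    sumFin {n} (λ t → sumFin (λ j → guard (inS ℰᶜ (combine t j)) (P Mᶜ x a (combine t j))))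
      ≤⟨ sumFin-mono-≤ (λ t → sumFin-guard-≤ (λ j → inS ℰᶜ (combine t j)) (inS ℰ t) (λ j → P Mᶜ x a (combine t j))
           (λ j tj∈S → subst (_∈S ℰ) (π-combine t j) (∈S-π tj∈S)) (λ j → Pᶜ-nonneg dist en (combine t j))) ⟩
    sumFin (λ t → guard (inS ℰ t) (sumFin (λ j → P Mᶜ x a (combine t j))))
      ≡⟨ sumFin-cong (λ t → cong (guard (inS ℰ t)) (sum-copies t x∈E)) ⟩
    sumFin (λ t → guard (inS ℰ t) (guard (inE E t) (P M (π x) a t)))
      ≤⟨ sumFin-mono-≤ (λ t → guard-mono (inS ℰ t) (guard-≤ (inE E t) (proj₁ (dist _ _ en) t))) ⟩
    mass M (π x) a ℰ ∎
    where
    open ≤-Reasoning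
    x∈E = proj₁ (enabledᶜ e)
    en  = proj₂ (enabledᶜ e)

  ℰ-closed : ∀ s a → (s , a) ∈ᴱ ℰ → mass M s a ℰ ≡ 1ℚ
  ℰ-closed s a e with i , eᶜ ← ∈ℰ⁻ e = subst (λ u → mass M u a ℰ ≡ 1ℚ) (π-combine s i) closed-π
    where
    x  = combine s i
    en = proj₂ (enabledᶜ eᶜ)
    closed-π : mass M (π x) a ℰ ≡ 1ℚ
    closed-π = ≤-antisym
      (≤-trans (sumFin-mono-≤ (λ t → guard-≤ (inS ℰ t) (proj₁ (dist _ _ en) t))) (≤-reflexive (proj₂ (dist _ _ en))))
      (subst (_≤ mass M (π x) a ℰ) (IsEC.closed ecᶜ x a eᶜ) (mass-π eᶜ))

  edge-π : ∀ {x y} → Edge Mᶜ ℰᶜ x y → Edge M ℰ (π x) (π y)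
  edge-π (x∈S , y∈S , a , e , 0<Pᶜ) = ∈S-π x∈S , ∈S-π y∈S , a , ∈ℰ⁺-π e , proj₁ (Pᶜ-pos⁻ 0<Pᶜ)

  ℰ-connected : ∀ s t → s ∈S ℰ → t ∈S ℰ → Star (Edge M ℰ) s t
  ℰ-connected s t s∈S t∈S
    with i , si∈S ← ∈S-copy s∈S
    with j , tj∈S ← ∈S-copy t∈S
    = subst₂ (Star (Edge M ℰ)) (π-combine s i) (π-combine t j)
             (gmap π edge-π (IsEC.connected ecᶜ _ _ si∈S tj∈S))

  ℰ-EC : IsEC M ℰ
  ℰ-EC = record
    { nonempty  = let x , a , e = IsEC.nonempty ecᶜ in π x , a , ∈ℰ⁺-π e
    ; enabled   = λ s a e → let i , eᶜ = ∈ℰ⁻ e in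
                    subst (λ u → En M u a ≡ true) (π-combine s i) (proj₂ (enabledᶜ eᶜ))
    ; closed    = ℰ-closed
    ; connected = ℰ-connected
    }

  ℰ⊆E : ∀ i s → s ∈S ℰ → s ∈ E i
  ℰ⊆E i s s∈S with j , sj∈S ← ∈S-copy s∈S =
    inE⁻ {E = E} (subst (λ u → inE E u ≡ true) (π-combine s j) (proj₁ (enabledᶜ (proj₂ (∈S⁻ ℰᶜ sj∈S))))) i

  leave-copy : ∀ {x y} → Star (Edge Mᶜ ℰᶜ) x y → index y ≢ index x → Hits ℰᶜ (index x)
  leave-copy ε ne = contradiction refl ne
  leave-copy {x} (_◅_ {j = x₁} (_ , _ , a , e , 0<Pᶜ) p) ne with lookup (F (index x)) (π x) Bool.≟ true
  ... | yes x∈F = hits-at {ℰᶜ} e x∈F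
  ... | no  x∉F = subst (Hits ℰᶜ) stay (leave-copy p (λ eq → ne (trans eq stay)))
    where
    stay : index x₁ ≡ index x
    stay = trans (sym (proj₂ (proj₂ (Pᶜ-pos⁻ 0<Pᶜ)))) (next-∉ x∉F)

  -- A successor of a pair at an F-state lies in the next copy, and the path back must leave that copy again.
  Hits-⊕1 : ∀ j → Hits ℰᶜ j → Hits ℰᶜ (⊕1 j)
  Hits-⊕1 j h with ⊕1 j ≟ j
  ... | yes ⊕1j≡j = subst (Hits ℰᶜ) (sym ⊕1j≡j) h
  ... | no  ⊕1j≢j
    with s , a , e , s∈F ← h
    with y , y∈S , 0<Pᶜ ← EC-successor ecᶜ e
    = subst (Hits ℰᶜ) y-index (leave-copy (IsEC.connected ecᶜ y (combine s j) y∈S (∈S⁺ ℰᶜ e)) copy-changes)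
    where
    y-index : index y ≡ ⊕1 j
    y-index = begin
      index y                                         ≡⟨ proj₂ (proj₂ (Pᶜ-pos⁻ 0<Pᶜ)) ⟨
      next (index (combine s j)) (π (combine s j))    ≡⟨ cong₂ next (index-combine s j) (π-combine s j) ⟩
      next j s                                        ≡⟨ next-∈ ([]=⇒lookup s∈F) ⟩
      ⊕1 j                                            ∎
      where open ≡-Reasoning
    copy-changes : index (combine s j) ≢ index y
    copy-changes eq = ⊕1j≢j (trans (sym y-index) (trans (sym eq) (index-combine s j)))

  ℰ-hits : HitsSome ℰᶜ → ∀ i → ∃[ s ] (s ∈S ℰ × s ∈ F i)
  ℰ-hits (s , i , a , e , s∈F) j
    with t , _ , eᶜ , t∈F ← ⊕1-invariant⇒all (Hits ℰᶜ) Hits-⊕1 (s , a , e , s∈F) j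
    = t , ∈S⁺ ℰ (∈ℰ⁺ eᶜ) , t∈F

mainTheorem13 : {n m k : ℕ} (M : MDP n m) → IsDistMDP M →
    (F E : Fin (suc k) → Subset n) → (ℰ : PairSet n m) →
    (IsEC M ℰ × (∀ i → ∃[ s ] (s ∈S ℰ × s ∈ F i)) × (∀ i s → s ∈S ℰ → s ∈ E i))
    ⇔
    (∃[ ℰ' ] (IsEC (copyMDP M F E) ℰ'
      × (∃[ s ] ∃[ i ] ∃[ a ] ((combine s i , a) ∈ᴱ ℰ' × s ∈ F i))
      × (∀ s a → (((s , a) ∈ᴱ ℰ) ⇔ (∃[ i ] ((combine s i , a) ∈ᴱ ℰ'))))))
mainTheorem13 M dist F E ℰ = mk⇔
  (λ (ec , hitsF , ℰ⊆E) → LiftEC.lifted-EC M dist F E ec ℰ⊆E hitsF)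
  (λ (ℰᶜ , ecᶜ , hits , projects) → let open ProjectEC M dist F E ecᶜ projects in ℰ-EC , ℰ-hits hits , ℰ⊆E)
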